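{- Let $G=(V,E)$ be a finite, simple, undirected graph, and for $v\in V$ let $N(v)$ denote the open neighborhood of $v$. Consider the integer linear program \[ \min\ 2\sum_{v\in V} y_v + 3\sum_{v\in V} z_v \] subject to, for every $v\in V$: \[ y_v+z_v+\tfrac12\sum_{u\in N(v)} y_u+\sum_{u\in N(v)} z_u\ \ge 1,\qquad y_v+z_v\le 1,\qquad y_v,z_v\in\{0,1\}. \] Then the optimal objective value of this program equals the double Roman domination number $\gamma_{dR}(G)$.
   Context: A double Roman dominating function (DRDF) on a graph $G=(V,E)$ is a function $f:V\to\{0,1,2,3\}$ such that: if $f(v)=0$ then $v$ has at least two neighbors $u$ with $f(u)=2$ or at least one neighbor $u$ with $f(u)=3$; and if $f(v)=1$ then $v$ has at least one neighbor $u$ with $f(u)\ge 2$. The weight of $f$ is $\sum_{v\in V} f(v)$, and the double Roman domination number $\gamma_{dR}(G)$ is the minimum weight of a DRDF on $G$. -}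

module Defs where

open import Data.Nat using (ℕ; zero; suc; _+_; _*_; _≤_; _≥_)
open import Data.Fin using (Fin; zero; suc)
open import Data.Bool using (Bool; true; false; if_then_else_)
open import Data.Product using (Σ; _×_; ∃; ∃-syntax; _,_)
open import Data.Sum using (_⊎_)
open import Relation.Binary.PropositionalEquality using (_≡_; _≢_)

record Graph : Set where
  field
    n      : ℕ
    adj    : Fin n → Fin n → Bool
    sym    : ∀ u v → adj u v ≡ adj v u
    irrefl : ∀ v → adj v v ≡ false

open Graph public

Vertex : Graph → Set
Vertex G = Fin (n G)

Adj : (G : Graph) → Vertex G → Vertex G → Set
Adj G v u = adj G v u ≡ true

∑ : (n : ℕ) → (Fin n → ℕ) → ℕ
∑ zero    f = 0
∑ (suc n) f = f zero + ∑ n (λ i → f (suc i))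

∑N : (G : Graph) → Vertex G → (Vertex G → ℕ) → ℕ
∑N G v x = ∑ (n G) (λ u → if adj G v u then x u else 0)

record IsDRDF (G : Graph) (f : Vertex G → ℕ) : Set where
  field
    bound : ∀ v → f v ≤ 3
    zero-cond : ∀ v → f v ≡ 0 →
      (∃[ u ] ∃[ w ] (u ≢ w × Adj G v u × Adj G v w × f u ≡ 2 × f w ≡ 2))
      ⊎ (∃[ u ] (Adj G v u × f u ≡ 3))
    one-cond : ∀ v → f v ≡ 1 → ∃[ u ] (Adj G v u × f u ≥ 2)

weight : (G : Graph) → (Vertex G → ℕ) → ℕ
weight G f = ∑ (n G) f

IsγdR : Graph → ℕ → Set
IsγdR G k =
  (∃[ f ] (IsDRDF G f × weight G f ≡ k))
  × (∀ f → IsDRDF G f → k ≤ weight G f)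

-- Feasibility.  y v, z v ∈ {0,1} is encoded as ℕ-values ≤ 1.
-- The covering constraint
--   y_v + z_v + ½ ∑_{u∈N(v)} y_u + ∑_{u∈N(v)} z_u ≥ 1
-- is stated multiplied by 2 (to stay in ℕ):
--   2 y_v + 2 z_v + ∑_{u∈N(v)} y_u + 2 ∑_{u∈N(v)} z_u ≥ 2.
record ILPFeasible (G : Graph) (y z : Vertex G → ℕ) : Set where
  field
    y01   : ∀ v → y v ≤ 1
    z01   : ∀ v → z v ≤ 1
    cover : ∀ v → 2 * y v + 2 * z v + ∑N G v y + 2 * ∑N G v z ≥ 2
    excl  : ∀ v → y v + z v ≤ 1

objective : (G : Graph) → (Vertex G → ℕ) → (Vertex G → ℕ) → ℕ
objective G y z = 2 * ∑ (n G) y + 3 * ∑ (n G) z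

IsILPOpt : Graph → ℕ → Set
IsILPOpt G k =
  (∃[ y ] ∃[ z ] (ILPFeasible G y z × objective G y z ≡ k))
  × (∀ y z → ILPFeasible G y z → k ≤ objective G y z)

-- A feasible point (y, z) is the double Roman dominating function 2y + 3z, whose
-- weight is the objective value; conversely a DRDF that never takes the value 1
-- is 2·[f = 2] + 3·[f = 3]. Every DRDF can be turned into one without 1s of no
-- larger weight: a vertex v with f(v) = 1 has a neighbour u with f(u) ≥ 2, and
-- moving v to 0 and u to 3 keeps f a DRDF, does not increase the weight and
-- removes one 1. The ILP optimum exists because there are finitely many 0/1 points.
module Submission where

open import Defs hiding (sym)
open import Data.Nat using (ℕ; zero; suc; _+_; _*_; _≤_; _≥_; z≤n; s≤s; s≤s⁻¹; _≤?_; _≡ᵇ_; pred)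
open import Data.Nat.Properties
  using (≤-refl; ≤-trans; ≤-antisym; ≤-reflexive; m≤m+n; m≤n+m; +-monoʳ-≤; *-monoʳ-≤;
         +-cancelʳ-≤; *-zeroʳ; +-comm; +-assoc; +-identityʳ; *-distribˡ-+; ≰⇒>; ≡ᵇ⇒≡; module ≤-Reasoning)
open import Data.Nat.Solver using (module +-*-Solver)
open import Data.Fin using (Fin; zero; suc)
open import Data.Fin.Properties using (_≟_; suc-injective; all?)
open import Data.Fin.Subset using (Subset)
open import Data.Fin.Subset.Properties using (anySubset?)
open import Data.Vec using (lookup; tabulate)
open import Data.Vec.Properties using (lookup∘tabulate)
open import Data.Vec.Functional using (updateAt)
open import Data.Vec.Functional.Properties using (updateAt-updates; updateAt-minimal)
open import Data.Bool using (true; false; if_then_else_; T)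
open import Data.Unit using (tt)
open import Data.Product using (Σ; _×_; ∃; ∃-syntax; _,_)
open import Data.Sum using (_⊎_; inj₁; inj₂)
open import Data.Empty using (⊥-elim)
open import Function using (_∘_; const)
open import Relation.Nullary using (Dec; yes; no)
open import Relation.Nullary.Decidable using (map′; _×-dec_)
open import Relation.Binary.PropositionalEquality
  using (_≡_; _≢_; _≗_; refl; sym; trans; cong; cong₂; subst; subst₂; module ≡-Reasoning)

∑-cong : ∀ n {f g : Fin n → ℕ} → f ≗ g → ∑ n f ≡ ∑ n g
∑-cong zero    f≗g = refl
∑-cong (suc n) f≗g = cong₂ _+_ (f≗g zero) (∑-cong n (f≗g ∘ suc))

∑-distrib-+ : ∀ n (f g : Fin n → ℕ) → ∑ n (λ i → f i + g i) ≡ ∑ n f + ∑ n g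
∑-distrib-+ zero    f g = refl
∑-distrib-+ (suc n) f g =
  trans (cong (f zero + g zero +_) (∑-distrib-+ n (f ∘ suc) (g ∘ suc)))
        (solve 4 (λ a b c d → (a :+ b) :+ (c :+ d) := (a :+ c) :+ (b :+ d)) refl
               (f zero) (g zero) (∑ n (f ∘ suc)) (∑ n (g ∘ suc)))
  where open +-*-Solver

*-distribˡ-∑ : ∀ n c (f : Fin n → ℕ) → ∑ n (λ i → c * f i) ≡ c * ∑ n f
*-distribˡ-∑ zero    c f = sym (*-zeroʳ c)
*-distribˡ-∑ (suc n) c f =
  trans (cong (c * f zero +_) (*-distribˡ-∑ n c (f ∘ suc))) (sym (*-distribˡ-+ c (f zero) _))

term≤∑ : ∀ n (f : Fin n → ℕ) i → f i ≤ ∑ n f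
term≤∑ (suc n) f zero    = m≤m+n _ _
term≤∑ (suc n) f (suc i) = ≤-trans (term≤∑ n (f ∘ suc) i) (m≤n+m _ _)

two-terms≤∑ : ∀ n (f : Fin n → ℕ) {i j} → i ≢ j → f i + f j ≤ ∑ n f
two-terms≤∑ (suc n) f {zero}  {zero}  0≢0 = ⊥-elim (0≢0 refl)
two-terms≤∑ (suc n) f {zero}  {suc j} _   = +-monoʳ-≤ (f zero) (term≤∑ n (f ∘ suc) j)
two-terms≤∑ (suc n) f {suc i} {zero}  _   =
  subst (_≤ ∑ (suc n) f) (+-comm (f zero) (f (suc i))) (+-monoʳ-≤ (f zero) (term≤∑ n (f ∘ suc) i))
two-terms≤∑ (suc n) f {suc i} {suc j} i≢j =
  ≤-trans (two-terms≤∑ n (f ∘ suc) (i≢j ∘ cong suc)) (m≤n+m _ _)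

positive-term : ∀ n (f : Fin n → ℕ) → 1 ≤ ∑ n f → ∃[ i ] 1 ≤ f i
positive-term (suc n) f 1≤∑ with f zero in eq
... | suc _ = zero , subst (1 ≤_) (sym eq) (s≤s z≤n)
... | zero  = let i , 1≤fi = positive-term n (f ∘ suc) 1≤∑ in suc i , 1≤fi

two-positive-terms : ∀ n (f : Fin n → ℕ) → (∀ i → f i ≤ 1) → 2 ≤ ∑ n f →
                     ∃[ i ] ∃[ j ] (i ≢ j × 1 ≤ f i × 1 ≤ f j)
two-positive-terms (suc n) f f≤1 2≤∑ with f zero in eq
... | zero = let i , j , i≢j , 1≤fi , 1≤fj = two-positive-terms n (f ∘ suc) (f≤1 ∘ suc) 2≤∑
             in suc i , suc j , i≢j ∘ suc-injective , 1≤fi , 1≤fj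
... | suc zero = let j , 1≤fj = positive-term n (f ∘ suc) (s≤s⁻¹ 2≤∑)
                 in zero , suc j , (λ ()) , subst (1 ≤_) (sym eq) (s≤s z≤n) , 1≤fj
... | suc (suc _) with s≤s () ← subst (_≤ 1) eq (f≤1 zero)

-- The identity is stated with both values added on the other side, avoiding subtraction.
∑-updateAt : ∀ n (h : ℕ → ℕ) (f : Fin n → ℕ) i a →
             ∑ n (h ∘ updateAt f i (const a)) + h (f i) ≡ ∑ n (h ∘ f) + h a
∑-updateAt (suc n) h f zero a =
  solve 3 (λ b s c → (b :+ s) :+ c := (c :+ s) :+ b) refl (h a) (∑ n (h ∘ f ∘ suc)) (h (f zero))
  where open +-*-Solver
∑-updateAt (suc n) h f (suc i) a = begin
  h (f zero) + ∑ n (h ∘ updateAt (f ∘ suc) i (const a)) + h (f (suc i))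
    ≡⟨ +-assoc (h (f zero)) _ _ ⟩
  h (f zero) + (∑ n (h ∘ updateAt (f ∘ suc) i (const a)) + h (f (suc i)))
    ≡⟨ cong (h (f zero) +_) (∑-updateAt n h (f ∘ suc) i a) ⟩
  h (f zero) + (∑ n (h ∘ f ∘ suc) + h a)
    ≡⟨ sym (+-assoc (h (f zero)) _ _) ⟩
  h (f zero) + ∑ n (h ∘ f ∘ suc) + h a ∎
  where open ≡-Reasoning

masked≡ : ∀ {b} (x : ℕ) → b ≡ true → (if b then x else 0) ≡ x
masked≡ x refl = refl

masked≤1 : ∀ b {x} → x ≤ 1 → (if b then x else 0) ≤ 1
masked≤1 true  x≤1 = x≤1
masked≤1 false _   = z≤n

masked-positive : ∀ b x → 1 ≤ (if b then x else 0) → b ≡ true × 1 ≤ x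
masked-positive true x 1≤x = refl , 1≤x

module _ (G : Graph) where

  ∑N-cong : ∀ v {x x' : Vertex G → ℕ} → x ≗ x' → ∑N G v x ≡ ∑N G v x'
  ∑N-cong v x≗x' = ∑-cong (n G) λ u → cong (if adj G v u then_else 0) (x≗x' u)

  neighbour≤∑N : ∀ {v u} (x : Vertex G → ℕ) → Adj G v u → x u ≤ ∑N G v x
  neighbour≤∑N {v} {u} x vu = subst (_≤ ∑N G v x) (masked≡ (x u) vu) (term≤∑ (n G) _ u)

  two-neighbours≤∑N : ∀ {v u w} (x : Vertex G → ℕ) → u ≢ w → Adj G v u → Adj G v w →
                      x u + x w ≤ ∑N G v x
  two-neighbours≤∑N {v} {u} {w} x u≢w vu vw =
    subst (_≤ ∑N G v x) (cong₂ _+_ (masked≡ (x u) vu) (masked≡ (x w) vw))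
          (two-terms≤∑ (n G) _ u≢w)

  positive-neighbour : ∀ {v} (x : Vertex G → ℕ) → 1 ≤ ∑N G v x → ∃[ u ] (Adj G v u × 1 ≤ x u)
  positive-neighbour {v} x 1≤∑ =
    let u , 1≤xu = positive-term (n G) _ 1≤∑ in u , masked-positive (adj G v u) (x u) 1≤xu

  two-positive-neighbours : ∀ {v} (x : Vertex G → ℕ) → (∀ u → x u ≤ 1) → 2 ≤ ∑N G v x →
                            ∃[ u ] ∃[ w ] (u ≢ w × Adj G v u × Adj G v w × 1 ≤ x u × 1 ≤ x w)
  two-positive-neighbours {v} x x≤1 2≤∑ =
    let u , w , u≢w , 1≤xu , 1≤xw = two-positive-terms (n G) _ (λ u → masked≤1 (adj G v u) (x≤1 u)) 2≤∑
        vu , 1≤xu = masked-positive (adj G v u) (x u) 1≤xu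
        vw , 1≤xw = masked-positive (adj G v w) (x w) 1≤xw
    in u , w , u≢w , vu , vw , 1≤xu , 1≤xw

Dominated₀ : (G : Graph) → (Vertex G → ℕ) → Vertex G → Set
Dominated₀ G f v = (∃[ u ] ∃[ w ] (u ≢ w × Adj G v u × Adj G v w × f u ≡ 2 × f w ≡ 2))
                 ⊎ (∃[ u ] (Adj G v u × f u ≡ 3))

Dominated₁ : (G : Graph) → (Vertex G → ℕ) → Vertex G → Set
Dominated₁ G f v = ∃[ u ] (Adj G v u × f u ≥ 2)

≥2⇒≢1 : ∀ {x} → 2 ≤ x → x ≢ 1
≥2⇒≢1 (s≤s ()) refl

two-or-three : ∀ {x} → 2 ≤ x → x ≤ 3 → x ≡ 2 ⊎ x ≡ 3
two-or-three {1} (s≤s ()) _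
two-or-three {2} _ _ = inj₁ refl
two-or-three {3} _ _ = inj₂ refl
two-or-three {suc (suc (suc (suc _)))} _ (s≤s (s≤s (s≤s ())))

module _ (G : Graph) {f g : Vertex G → ℕ}
         (heavy-raised : ∀ a → 2 ≤ f a → f a ≤ g a) (g≤3 : ∀ a → g a ≤ 3) where

  Dominated₁-mono : ∀ {v} → Dominated₁ G f v → Dominated₁ G g v
  Dominated₁-mono (a , va , 2≤fa) = a , va , ≤-trans 2≤fa (heavy-raised a 2≤fa)

  private
    raised : ∀ {a k} → f a ≡ k → 2 ≤ k → k ≤ g a
    raised refl 2≤k = heavy-raised _ 2≤k

  Dominated₀-mono : ∀ {v} → Dominated₀ G f v → Dominated₀ G g v
  Dominated₀-mono (inj₂ (a , va , fa≡3)) = inj₂ (a , va , ≤-antisym (g≤3 a) (raised fa≡3 (s≤s (s≤s z≤n))))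
  Dominated₀-mono (inj₁ (a , b , a≢b , va , vb , fa≡2 , fb≡2))
    with two-or-three (raised fa≡2 ≤-refl) (g≤3 a) | two-or-three (raised fb≡2 ≤-refl) (g≤3 b)
  ... | inj₂ ga≡3 | _         = inj₂ (a , va , ga≡3)
  ... | inj₁ _    | inj₂ gb≡3 = inj₂ (b , vb , gb≡3)
  ... | inj₁ ga≡2 | inj₁ gb≡2 = inj₁ (a , b , a≢b , va , vb , ga≡2 , gb≡2)

𝟙[_≡_] : ℕ → ℕ → ℕ
𝟙[ a ≡ b ] = if a ≡ᵇ b then 1 else 0

𝟙≤1 : ∀ a b → 𝟙[ a ≡ b ] ≤ 1
𝟙≤1 a b with a ≡ᵇ b
... | true  = ≤-refl
... | false = z≤n

𝟙-≢ : ∀ {a b} → a ≢ b → 𝟙[ a ≡ b ] ≡ 0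
𝟙-≢ {a} {b} a≢b with a ≡ᵇ b in eq
... | true  = ⊥-elim (a≢b (≡ᵇ⇒≡ a b (subst T (sym eq) tt)))
... | false = refl

𝟙-positive : ∀ {a b} → 1 ≤ 𝟙[ a ≡ b ] → a ≡ b
𝟙-positive {a} {b} 1≤𝟙 with a ≡ᵇ b in eq
... | true = ≡ᵇ⇒≡ a b (subst T (sym eq) tt)

𝟙-bit : ∀ {x} → x ≤ 1 → 𝟙[ x ≡ 1 ] ≡ x
𝟙-bit {0} _ = refl
𝟙-bit {1} _ = refl
𝟙-bit {suc (suc _)} (s≤s ())

𝟙2+𝟙3≤1 : ∀ x → 𝟙[ x ≡ 2 ] + 𝟙[ x ≡ 3 ] ≤ 1
𝟙2+𝟙3≤1 0 = z≤n
𝟙2+𝟙3≤1 1 = z≤n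
𝟙2+𝟙3≤1 2 = ≤-refl
𝟙2+𝟙3≤1 3 = ≤-refl
𝟙2+𝟙3≤1 (suc (suc (suc (suc _)))) = z≤n

2*𝟙2+3*𝟙3 : ∀ {x} → x ≤ 3 → x ≢ 1 → 2 * 𝟙[ x ≡ 2 ] + 3 * 𝟙[ x ≡ 3 ] ≡ x
2*𝟙2+3*𝟙3 {0} _ _   = refl
2*𝟙2+3*𝟙3 {1} _ 1≢1 = ⊥-elim (1≢1 refl)
2*𝟙2+3*𝟙3 {2} _ _   = refl
2*𝟙2+3*𝟙3 {3} _ _   = refl
2*𝟙2+3*𝟙3 {suc (suc (suc (suc _)))} (s≤s (s≤s (s≤s ()))) _

data Bits : ℕ → ℕ → Set where
  neither : Bits 0 0
  only-y  : Bits 1 0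
  only-z  : Bits 0 1

bits : ∀ {y z} → y ≤ 1 → z ≤ 1 → y + z ≤ 1 → Bits y z
bits {0} {0} _ _ _ = neither
bits {1} {0} _ _ _ = only-y
bits {0} {1} _ _ _ = only-z
bits {1} {suc _} _ _ (s≤s ())
bits {0} {suc (suc _)} _ (s≤s ()) _
bits {suc (suc _)} (s≤s ()) _ _

bits-value≤3 : ∀ {y z} → Bits y z → 2 * y + 3 * z ≤ 3
bits-value≤3 neither = z≤n
bits-value≤3 only-y  = s≤s (s≤s z≤n)
bits-value≤3 only-z  = ≤-refl

bits-value≢1 : ∀ {y z} → Bits y z → 2 * y + 3 * z ≢ 1
bits-value≢1 neither ()
bits-value≢1 only-y  ()
bits-value≢1 only-z  ()

bits-value≡0 : ∀ {y z} → Bits y z → 2 * y + 3 * z ≡ 0 → y ≡ 0 × z ≡ 0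
bits-value≡0 neither _ = refl , refl

bits-y : ∀ {y z} → Bits y z → 1 ≤ y → 2 * y + 3 * z ≡ 2
bits-y only-y _ = refl

bits-z : ∀ {y z} → Bits y z → 1 ≤ z → 2 * y + 3 * z ≡ 3
bits-z only-z _ = refl

≥2-cases : ∀ s t → 2 ≤ s + 2 * t → 1 ≤ t ⊎ 2 ≤ s
≥2-cases s zero    2≤s+0 = inj₂ (subst (2 ≤_) (+-identityʳ s) 2≤s+0)
≥2-cases s (suc t) _     = inj₁ (s≤s z≤n)

module _ {G : Graph} {y z : Vertex G → ℕ} (F : ILPFeasible G y z) where
  open ILPFeasible F

  feasible⇒DRDF : IsDRDF G (λ v → 2 * y v + 3 * z v)
  feasible⇒DRDF = record
    { bound     = λ v → bits-value≤3 (bits-at v)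
    ; zero-cond = dominated
    ; one-cond  = λ v value≡1 → ⊥-elim (bits-value≢1 (bits-at v) value≡1)
    }
    where
    bits-at : ∀ v → Bits (y v) (z v)
    bits-at v = bits (y01 v) (z01 v) (excl v)

    dominated : ∀ v → 2 * y v + 3 * z v ≡ 0 → Dominated₀ G (λ v → 2 * y v + 3 * z v) v
    dominated v value≡0 with bits-value≡0 (bits-at v) value≡0
    ... | y≡0 , z≡0
      with ≥2-cases (∑N G v y) (∑N G v z)
             (subst (2 ≤_) (cong₂ (λ a b → 2 * a + 2 * b + ∑N G v y + 2 * ∑N G v z) y≡0 z≡0) (cover v))
    ... | inj₁ 1≤∑z = let u , vu , 1≤zu = positive-neighbour G z 1≤∑z
                      in inj₂ (u , vu , bits-z (bits-at u) 1≤zu)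
    ... | inj₂ 2≤∑y = let u , w , u≢w , vu , vw , 1≤yu , 1≤yw = two-positive-neighbours G y y01 2≤∑y
                      in inj₁ (u , w , u≢w , vu , vw , bits-y (bits-at u) 1≤yu , bits-y (bits-at w) 1≤yw)

weight-2y+3z : ∀ G (y z : Vertex G → ℕ) → weight G (λ v → 2 * y v + 3 * z v) ≡ objective G y z
weight-2y+3z G y z =
  trans (∑-distrib-+ (n G) _ _) (cong₂ _+_ (*-distribˡ-∑ (n G) 2 y) (*-distribˡ-∑ (n G) 3 z))

module _ {G : Graph} {f : Vertex G → ℕ} (D : IsDRDF G f) (no-one : ∀ v → f v ≢ 1) where
  open IsDRDF D

  one-free-DRDF⇒feasible : ILPFeasible G (λ v → 𝟙[ f v ≡ 2 ]) (λ v → 𝟙[ f v ≡ 3 ])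
  one-free-DRDF⇒feasible = record
    { y01   = λ v → 𝟙≤1 (f v) 2
    ; z01   = λ v → 𝟙≤1 (f v) 3
    ; cover = covered
    ; excl  = λ v → 𝟙2+𝟙3≤1 (f v)
    }
    where
    y z : Vertex G → ℕ
    y v = 𝟙[ f v ≡ 2 ]
    z v = 𝟙[ f v ≡ 3 ]

    covered : ∀ v → 2 * y v + 2 * z v + ∑N G v y + 2 * ∑N G v z ≥ 2
    covered v with f v in fv | bound v
    ... | 1 | _ = ⊥-elim (no-one v fv)
    ... | 2 | _ = s≤s (s≤s z≤n)
    ... | 3 | _ = s≤s (s≤s z≤n)
    ... | suc (suc (suc (suc _))) | s≤s (s≤s (s≤s ()))
    ... | 0 | _ with zero-cond v fv
    ... | inj₁ (u , w , u≢w , vu , vw , fu≡2 , fw≡2) =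
      ≤-trans (subst (_≤ ∑N G v y) (cong₂ (λ a b → 𝟙[ a ≡ 2 ] + 𝟙[ b ≡ 2 ]) fu≡2 fw≡2)
                     (two-neighbours≤∑N G y u≢w vu vw))
              (m≤m+n _ _)
    ... | inj₂ (u , vu , fu≡3) =
      ≤-trans (*-monoʳ-≤ 2 (subst (_≤ ∑N G v z) (cong (λ a → 𝟙[ a ≡ 3 ]) fu≡3) (neighbour≤∑N G z vu)))
              (m≤n+m (2 * ∑N G v z) (∑N G v y))

  objective-𝟙≡weight : objective G (λ v → 𝟙[ f v ≡ 2 ]) (λ v → 𝟙[ f v ≡ 3 ]) ≡ weight G f
  objective-𝟙≡weight =
    trans (sym (weight-2y+3z G _ _)) (∑-cong (n G) λ v → 2*𝟙2+3*𝟙3 (bound v) (no-one v))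

ones : (G : Graph) → (Vertex G → ℕ) → ℕ
ones G f = ∑ (n G) (λ v → 𝟙[ f v ≡ 1 ])

reassign : ∀ {m} → (Fin m → ℕ) → Fin m → Fin m → Fin m → ℕ
reassign f v u = updateAt (updateAt f v (const 0)) u (const 3)

reassign-cases : ∀ {m} (f : Fin m → ℕ) v u w →
                 reassign f v u w ≡ 3 ⊎ (w ≡ v × reassign f v u w ≡ 0) ⊎ reassign f v u w ≡ f w
reassign-cases f v u w with w ≟ u | w ≟ v
... | yes refl | _        = inj₁ (updateAt-updates w _)
... | no w≢u   | yes refl = inj₂ (inj₁ (refl , trans (updateAt-minimal w u _ w≢u) (updateAt-updates w f)))
... | no w≢u   | no w≢v   = inj₂ (inj₂ (trans (updateAt-minimal w u _ w≢u) (updateAt-minimal w v f w≢v)))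

module _ (G : Graph) {f : Vertex G → ℕ} (D : IsDRDF G f) {v u : Vertex G}
         (fv≡1 : f v ≡ 1) (vu : Adj G v u) (2≤fu : 2 ≤ f u) where
  open IsDRDF D

  private
    g : Vertex G → ℕ
    g = reassign f v u

    f′ : Vertex G → ℕ
    f′ = updateAt f v (const 0)

    v≢u : v ≢ u
    v≢u refl = ≥2⇒≢1 2≤fu fv≡1

    f′u≡fu : f′ u ≡ f u
    f′u≡fu = updateAt-minimal u v f (v≢u ∘ sym)

    f′u≢1 : f′ u ≢ 1
    f′u≢1 = ≥2⇒≢1 (subst (2 ≤_) (sym f′u≡fu) 2≤fu)

    g≤3 : ∀ w → g w ≤ 3
    g≤3 w with reassign-cases f v u w
    ... | inj₁ gw≡3            = ≤-reflexive gw≡3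
    ... | inj₂ (inj₁ (_ , gw≡0)) = subst (_≤ 3) (sym gw≡0) z≤n
    ... | inj₂ (inj₂ gw≡fw)    = subst (_≤ 3) (sym gw≡fw) (bound w)

    heavy-raised : ∀ a → 2 ≤ f a → f a ≤ g a
    heavy-raised a 2≤fa with reassign-cases f v u a
    ... | inj₁ ga≡3               = subst (f a ≤_) (sym ga≡3) (bound a)
    ... | inj₂ (inj₁ (refl , _))  = ⊥-elim (≥2⇒≢1 2≤fa fv≡1)
    ... | inj₂ (inj₂ ga≡fa)       = ≤-reflexive (sym ga≡fa)

  reassign-DRDF : IsDRDF G g
  reassign-DRDF = record { bound = g≤3 ; zero-cond = dominated₀ ; one-cond = dominated₁ }
    where
    dominated₀ : ∀ w → g w ≡ 0 → Dominated₀ G g w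
    dominated₀ w gw≡0 with reassign-cases f v u w
    ... | inj₁ gw≡3              with () ← trans (sym gw≡3) gw≡0
    ... | inj₂ (inj₁ (refl , _)) = inj₂ (u , vu , updateAt-updates u f′)
    ... | inj₂ (inj₂ gw≡fw)      =
      Dominated₀-mono G heavy-raised g≤3 (zero-cond w (trans (sym gw≡fw) gw≡0))

    dominated₁ : ∀ w → g w ≡ 1 → Dominated₁ G g w
    dominated₁ w gw≡1 with reassign-cases f v u w
    ... | inj₁ gw≡3               with () ← trans (sym gw≡3) gw≡1
    ... | inj₂ (inj₁ (_ , gw≡0))  with () ← trans (sym gw≡0) gw≡1
    ... | inj₂ (inj₂ gw≡fw)       =
      Dominated₁-mono G heavy-raised g≤3 (one-cond w (trans (sym gw≡fw) gw≡1))

  reassign-weight : weight G g ≤ weight G f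
  reassign-weight = +-cancelʳ-≤ 2 (weight G g) (weight G f) (begin
    weight G g + 2          ≤⟨ +-monoʳ-≤ (weight G g) (subst (2 ≤_) (sym f′u≡fu) 2≤fu) ⟩
    weight G g + f′ u       ≡⟨ ∑-updateAt (n G) (λ x → x) f′ u 3 ⟩
    weight G f′ + 3         ≡⟨ +-assoc (weight G f′) 1 2 ⟨
    weight G f′ + 1 + 2     ≡⟨ cong (λ x → weight G f′ + x + 2) fv≡1 ⟨
    weight G f′ + f v + 2   ≡⟨ cong (_+ 2) (trans (∑-updateAt (n G) (λ x → x) f v 0) (+-identityʳ _)) ⟩
    weight G f + 2          ∎)
    where open ≤-Reasoning

  reassign-ones : suc (ones G g) ≡ ones G f
  reassign-ones = begin
    suc (ones G g)        ≡⟨ +-comm 1 (ones G g) ⟩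
    ones G g + 1          ≡⟨ cong (_+ 1) ones-g≡ones-f′ ⟩
    ones G f′ + 1         ≡⟨ cong (λ x → ones G f′ + 𝟙[ x ≡ 1 ]) fv≡1 ⟨
    ones G f′ + 𝟙[ f v ≡ 1 ] ≡⟨ ∑-updateAt (n G) (λ x → 𝟙[ x ≡ 1 ]) f v 0 ⟩
    ones G f + 0          ≡⟨ +-identityʳ (ones G f) ⟩
    ones G f              ∎
    where
    open ≡-Reasoning
    ones-g≡ones-f′ : ones G g ≡ ones G f′
    ones-g≡ones-f′ = begin
      ones G g                  ≡⟨ +-identityʳ (ones G g) ⟨
      ones G g + 0              ≡⟨ cong (ones G g +_) (𝟙-≢ f′u≢1) ⟨
      ones G g + 𝟙[ f′ u ≡ 1 ] ≡⟨ ∑-updateAt (n G) (λ x → 𝟙[ x ≡ 1 ]) f′ u 3 ⟩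
      ones G f′ + 0             ≡⟨ +-identityʳ (ones G f′) ⟩
      ones G f′                 ∎

one-free-form : ∀ G m {f} → IsDRDF G f → ones G f ≡ m →
                ∃[ g ] (IsDRDF G g × (∀ v → g v ≢ 1) × weight G g ≤ weight G f)
one-free-form G zero {f} D ones≡0 = f , D , no-one , ≤-refl
  where
  no-one : ∀ v → f v ≢ 1
  no-one v fv≡1 with () ← subst₂ _≤_ (cong (λ x → 𝟙[ x ≡ 1 ]) fv≡1) ones≡0 (term≤∑ (n G) _ v)
one-free-form G (suc m) D ones≡1+m =
  let v , 1≤𝟙       = positive-term (n G) _ (subst (1 ≤_) (sym ones≡1+m) (s≤s z≤n))
      fv≡1          = 𝟙-positive 1≤𝟙
      u , vu , 2≤fu = IsDRDF.one-cond D v fv≡1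
      g , g-DRDF , no-one , wg≤ = one-free-form G m (reassign-DRDF G D fv≡1 vu 2≤fu)
                                    (cong pred (trans (reassign-ones G D fv≡1 vu 2≤fu) ones≡1+m))
  in g , g-DRDF , no-one , ≤-trans wg≤ (reassign-weight G D fv≡1 vu 2≤fu)

minimiser : {A : Set} (P : A → Set) (cost : A → ℕ) → (∀ m → Dec (∃[ a ] (P a × cost a ≤ m))) →
            ∀ a → P a → ∃[ a* ] (P a* × ∀ b → P b → cost a* ≤ cost b)
minimiser P cost P≤? a Pa = below (cost a) (a , Pa , ≤-refl)
  where
  below : ∀ m → ∃[ a ] (P a × cost a ≤ m) → ∃[ a* ] (P a* × ∀ b → P b → cost a* ≤ cost b)
  below zero    (a , Pa , ca≤0) = a , Pa , λ b _ → ≤-trans ca≤0 z≤n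
  below (suc m) (a , Pa , ca≤1+m) with P≤? m
  ... | yes below-m = below m below-m
  ... | no  none    = a , Pa , λ b Pb → ≤-trans ca≤1+m (≰⇒> λ cb≤m → none (b , Pb , cb≤m))

ilpFeasible? : ∀ G (y z : Vertex G → ℕ) → Dec (ILPFeasible G y z)
ilpFeasible? G y z =
  map′ (λ (y01 , z01 , cover , excl) → record { y01 = y01 ; z01 = z01 ; cover = cover ; excl = excl })
       (λ F → let open ILPFeasible F in y01 , z01 , cover , excl)
       (all? (λ v → y v ≤? 1) ×-dec all? (λ v → z v ≤? 1)
         ×-dec all? (λ v → 2 ≤? 2 * y v + 2 * z v + ∑N G v y + 2 * ∑N G v z)
         ×-dec all? (λ v → y v + z v ≤? 1))

ILPFeasible-resp : ∀ G {y y′ z z′ : Vertex G → ℕ} → y ≗ y′ → z ≗ z′ → ILPFeasible G y z → ILPFeasible G y′ z′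
ILPFeasible-resp G {y} {y′} {z} {z′} y≗y′ z≗z′ F = record
  { y01   = λ v → subst (_≤ 1) (y≗y′ v) (y01 v)
  ; z01   = λ v → subst (_≤ 1) (z≗z′ v) (z01 v)
  ; cover = λ v → subst (2 ≤_)
      (cong₂ (λ a b → a + b) (cong₂ (λ a b → 2 * a + 2 * b + ∑N G v y′) (y≗y′ v) (z≗z′ v))
             (cong (2 *_) (∑N-cong G v z≗z′)))
      (subst (λ s → 2 ≤ 2 * y v + 2 * z v + s + 2 * ∑N G v z) (∑N-cong G v y≗y′) (cover v))
  ; excl  = λ v → subst (_≤ 1) (cong₂ _+_ (y≗y′ v) (z≗z′ v)) (excl v)
  }
  where open ILPFeasible F

objective-cong : ∀ G {y y′ z z′ : Vertex G → ℕ} → y ≗ y′ → z ≗ z′ → objective G y z ≡ objective G y′ z′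
objective-cong G y≗y′ z≗z′ = cong₂ (λ a b → 2 * a + 3 * b) (∑-cong (n G) y≗y′) (∑-cong (n G) z≗z′)

indicator : ∀ {m} → Subset m → Fin m → ℕ
indicator Y v = if lookup Y v then 1 else 0

toSubset : ∀ {m} → (Fin m → ℕ) → Subset m
toSubset x = tabulate (λ v → x v ≡ᵇ 1)

indicator-toSubset : ∀ {m} {x : Fin m → ℕ} → (∀ v → x v ≤ 1) → indicator (toSubset x) ≗ x
indicator-toSubset {x = x} x≤1 v rewrite lookup∘tabulate (λ w → x w ≡ᵇ 1) v = 𝟙-bit (x≤1 v)

ilp-optimum : ∀ G → ∃[ y ] ∃[ z ] (ILPFeasible G y z ×
                                  ∀ y′ z′ → ILPFeasible G y′ z′ → objective G y z ≤ objective G y′ z′)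
ilp-optimum G =
  let (Y , Z) , F , optimal = minimiser Feasible cost feasible≤? (toSubset (const 0) , toSubset (const 1)) (as-subsets all-three)
  in indicator Y , indicator Z , F ,
     λ y z Fyz → subst (cost (Y , Z) ≤_) (objective-of-subsets Fyz) (optimal (toSubset y , toSubset z) (as-subsets Fyz))
  where
  Feasible : Subset (n G) × Subset (n G) → Set
  Feasible (Y , Z) = ILPFeasible G (indicator Y) (indicator Z)

  cost : Subset (n G) × Subset (n G) → ℕ
  cost (Y , Z) = objective G (indicator Y) (indicator Z)

  feasible≤? : ∀ m → Dec (∃[ YZ ] (Feasible YZ × cost YZ ≤ m))
  feasible≤? m = map′ (λ (Y , Z , p) → (Y , Z) , p) (λ ((Y , Z) , p) → Y , Z , p)
    (anySubset? λ Y → anySubset? λ Z → ilpFeasible? G _ _ ×-dec (cost (Y , Z) ≤? m))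

  as-subsets : ∀ {y z} → ILPFeasible G y z → Feasible (toSubset y , toSubset z)
  as-subsets F = ILPFeasible-resp G (sym ∘ indicator-toSubset (ILPFeasible.y01 F))
                                    (sym ∘ indicator-toSubset (ILPFeasible.z01 F)) F

  objective-of-subsets : ∀ {y z} → ILPFeasible G y z → cost (toSubset y , toSubset z) ≡ objective G y z
  objective-of-subsets F = objective-cong G (indicator-toSubset (ILPFeasible.y01 F))
                                            (indicator-toSubset (ILPFeasible.z01 F))

  all-three : ILPFeasible G (const 0) (const 1)
  all-three = record { y01 = λ _ → z≤n ; z01 = λ _ → ≤-refl ; cover = λ _ → s≤s (s≤s z≤n) ; excl = λ _ → ≤-refl }

theorem4 : (G : Graph) → Σ ℕ (λ k → IsILPOpt G k × IsγdR G k)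
theorem4 G with ilp-optimum G
... | y , z , F , optimal =
  objective G y z , ((y , z , F , refl) , optimal) , ((_ , feasible⇒DRDF F , weight-2y+3z G y z) , minimal)
  where
  minimal : ∀ f → IsDRDF G f → objective G y z ≤ weight G f
  minimal f D =
    let g , g-DRDF , no-one , wg≤wf = one-free-form G (ones G f) D refl
    in begin
      objective G y z                                       ≤⟨ optimal _ _ (one-free-DRDF⇒feasible g-DRDF no-one) ⟩
      objective G (λ v → 𝟙[ g v ≡ 2 ]) (λ v → 𝟙[ g v ≡ 3 ]) ≡⟨ objective-𝟙≡weight g-DRDF no-one ⟩
      weight G g                                            ≤⟨ wg≤wf ⟩
      weight G f                                            ∎
    where open ≤-Reasoning
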